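{- Let $N\in\mathbb{N}$ be composite and let $p$ be a prime factor of $N$ such that $p\leq b$ for some $b\leq N/5$. Let $r,m\in\mathbb{N}$ with $2\leq m<p$, $\gcd(N,m)=1$ and $r=p \bmod m$. Define $H=X-m^{ -1}r+1\in\mathbb{Z}_N[X]$ (where $m^{ -1}$ is the inverse of $m$ modulo $N$) and set $k=\lceil (b/m)^{1/2}\rceil$. Then at least one of the elements \[ H_k(-k),\ H_k(-2k),\ \dots,\ H_k(-k^2) \] is noninvertible modulo $N$. Moreover, if $j\in\{1,\dots,k\}$ is such that $H_k(-jk)$ is noninvertible, then $\gcd\big((-jk-m^{ -1}r+i \bmod N),\,N\big)$ is a nontrivial factor of $N$ (i.e. different from $1$ and $N$) for some $i\in\{1,\dots,k\}$.
   Context: $\mathbb{Z}_N:=\mathbb{Z}/N\mathbb{Z}$. For a polynomial $H\in\mathbb{Z}_N[X]$ of degree $1$ and $k\in\mathbb{N}$, $H_k(X):=H(X)H(X+1)\cdots H(X+k-1)$. The notation $r=p\bmod m$ means $r$ is the remainder of $p$ upon division by $m$. -}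

module Defs where

open import Data.Nat as ℕ using (ℕ; zero; suc)
open import Data.Integer as ℤ using (ℤ; +_; _+_; _-_; _*_; -_)
open import Data.Integer.Divisibility using (_∣_)
open import Data.Product using (∃-syntax)

-- Elements of ℤ_N are represented by integers; equality in ℤ_N is
-- congruence modulo N.

InvertibleMod : ℕ → ℤ → Set
InvertibleMod N a = ∃[ y ] ((+ N) ∣ (a * y - + 1))

IsInverseMod : ℕ → ℕ → ℤ → Set
IsInverseMod N m minv = (+ N) ∣ ((+ m) * minv - + 1)

H : (minv : ℤ) (r : ℕ) → ℤ → ℤ
H minv r x = x - minv * (+ r) + + 1

Hk : (minv : ℤ) (r : ℕ) → ℕ → ℤ → ℤ
Hk minv r zero    x = + 1
Hk minv r (suc k) x = Hk minv r k x * H minv r (x + + k)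

-- k = ⌈(b/m)^{1/2}⌉, characterised exactly for naturals b, m with m ≥ 1:
-- k is the least natural number with k² ≥ b/m, i.e. b ≤ m k² and m (k-1)² < b
-- (for k = 0 the second condition is dropped).
IsCeilSqrtDiv : (b m k : ℕ) → Set
IsCeilSqrtDiv b m zero    = b ℕ.≤ 0
IsCeilSqrtDiv b m (suc k) = (b ℕ.≤ m ℕ.* (suc k ℕ.* suc k)) Data.Product.× (m ℕ.* (k ℕ.* k) ℕ.< b)

module Submission where

-- Write p = r + q m with 0 < r < m (p is prime and 2 ≤ m < p).  The key
-- identity is that, because m m⁻¹ ≡ 1 (mod N),
--     m · H(-(n + 1 + t) + t) ≡ -(r + n m)   (mod N, and so mod every divisor of N).
-- (1) Since q m < p ≤ b ≤ m k², we have q < k², so q + t + 1 = j k for some block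
--     index 1 ≤ j ≤ k and offset t < k; then p divides m H(-jk + t), hence (p ∤ m)
--     the factor H(-jk + t) of H_k(-jk), which is therefore not a unit mod N.
-- (2) If H_k(-jk) is not a unit, some factor H(-jk + t) has residue not coprime
--     to N.  Its gcd with N is not N: otherwise N ∣ r + s m with s = jk - t - 1,
--     but 0 < r + s m < m k² < 4 b < N by the choice of k.

module UnitsModN where
  open import Data.Nat as ℕ using (ℕ; zero; suc)
  import Data.Nat.Properties as ℕ
  import Data.Nat.Divisibility as ℕ
  open import Data.Nat.DivMod using (m<n⇒m%n≡m)
  open import Data.Nat.GCD using (gcd; GCD; gcd-GCD; gcd[m,n]∣m; module Bézout)
  open import Data.Nat.Primality using (Prime; prime⇒nonTrivial; euclidsLemma)
  open import Data.Integer hiding (suc)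
  open import Data.Integer.Properties
    using (pos-+; pos-*; abs-*; *-comm; +-identityʳ; neg-distribˡ-*; neg-involutive)
  open import Data.Integer.DivMod using (a≡a%ℕn+[a/ℕn]*n; n%ℕd<d)
  open import Data.Integer.Divisibility.Signed
    using (divides; ∣ᵤ⇒∣; ∣⇒∣ᵤ; ∣-trans; ∣m∣n⇒∣m+n; ∣m∣n⇒∣m-n; ∣m+n∣n⇒∣m; ∣m⇒∣-m; ∣m⇒∣m*n; ∣n⇒∣m*n)
    renaming (_∣_ to _∣ℤ_)
  open import Data.Integer.Tactic.RingSolver using (solve-∀)
  open import Data.Sum using (inj₁; inj₂)
  open import Data.Empty using (⊥-elim)
  open import Data.Product using (∃-syntax; _×_; _,_)
  open import Relation.Nullary using (¬_; Dec; yes; no)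
  open import Relation.Binary.PropositionalEquality
    using (_≡_; _≢_; refl; sym; trans; cong; subst; module ≡-Reasoning)
  open import Function.Bundles using (_⇔_; mk⇔)
  open import Defs
  open ≡-Reasoning

  add-sub-cancel : ∀ u v → u + v - u ≡ v
  add-sub-cancel = solve-∀

  pos-affine : ∀ a b c → + (a ℕ.+ b ℕ.* c) ≡ + a + + b * + c
  pos-affine a b c = trans (pos-+ a (b ℕ.* c)) (cong (λ v → + a + v) (pos-* b c))

  -- Invertibility modulo N is stated with unsigned divisibility in Defs;
  -- the signed notion has the better algebra, and the two agree.
  invertible⇒∣ℤ : ∀ {N} a → InvertibleMod N a → ∃[ y ] (+ N ∣ℤ a * y - 1ℤ)
  invertible⇒∣ℤ a (y , N∣) = y , ∣ᵤ⇒∣ N∣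

  ∣ℤ⇒invertible : ∀ {N} a y → + N ∣ℤ a * y - 1ℤ → InvertibleMod N a
  ∣ℤ⇒invertible a y N∣ = y , ∣⇒∣ᵤ N∣

  -- An element sharing a prime factor p with N is not a unit of ℤ_N:
  -- p would divide a*y - (a*y - 1) = 1.
  prime-factor⇒noninvertible : ∀ {N p} a → Prime p → p ℕ.∣ N → + p ∣ℤ a → ¬ InvertibleMod N a
  prime-factor⇒noninvertible {N} {p} a pp p∣N p∣a inv with invertible⇒∣ℤ a inv
  ... | y , N∣ay-1 = ℕ.nonTrivial⇒≢1 {{prime⇒nonTrivial pp}} (ℕ.∣1⇒≡1 (∣⇒∣ᵤ p∣1))
    where
    cancel : ∀ a y → a * y - (a * y - 1ℤ) ≡ 1ℤ
    cancel = solve-∀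
    p∣1 : + p ∣ℤ 1ℤ
    p∣1 = subst (+ p ∣ℤ_) (cancel a y)
            (∣m∣n⇒∣m-n (∣m⇒∣m*n y p∣a) (∣-trans (∣ᵤ⇒∣ {+ p} {+ N} p∣N) N∣ay-1))

  invertible-* : ∀ {N} a b → InvertibleMod N a → InvertibleMod N b → InvertibleMod N (a * b)
  invertible-* {N} a b inv-a inv-b with invertible⇒∣ℤ a inv-a | invertible⇒∣ℤ b inv-b
  ... | y , N∣ay-1 | z , N∣bz-1 = ∣ℤ⇒invertible (a * b) (y * z)
        (subst (+ N ∣ℤ_) (sym (split a b y z)) (∣m∣n⇒∣m+n (∣m⇒∣m*n (b * z) N∣ay-1) N∣bz-1))
    where
    split : ∀ a b y z → a * b * (y * z) - 1ℤ ≡ (a * y - 1ℤ) * (b * z) + (b * z - 1ℤ)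
    split = solve-∀

  invertible-resp-≡mod : ∀ {N} a b → + N ∣ℤ a - b → InvertibleMod N b → InvertibleMod N a
  invertible-resp-≡mod {N} a b N∣a-b inv-b with invertible⇒∣ℤ b inv-b
  ... | y , N∣by-1 = ∣ℤ⇒invertible a y
        (subst (+ N ∣ℤ_) (sym (shift a b y)) (∣m∣n⇒∣m+n N∣by-1 (∣m⇒∣m*n y N∣a-b)))
    where
    shift : ∀ a b y → a * y - 1ℤ ≡ (b * y - 1ℤ) + (a - b) * y
    shift = solve-∀

  ≡mod-residue : ∀ N .{{_ : ℕ.NonZero N}} a → + N ∣ℤ a - + (a %ℕ N)
  ≡mod-residue N a = divides (a /ℕ N) (begin
      a - + (a %ℕ N)                                  ≡⟨ cong (_- + (a %ℕ N)) (a≡a%ℕn+[a/ℕn]*n a N) ⟩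
      + (a %ℕ N) + a /ℕ N * + N - + (a %ℕ N)          ≡⟨ add-sub-cancel (+ (a %ℕ N)) (a /ℕ N * + N) ⟩
      a /ℕ N * + N                                    ∎)

  bézout⁺⇒invertible : ∀ {N} u X Y → 1ℤ + Y * + N ≡ X * u → InvertibleMod N u
  bézout⁺⇒invertible {N} u X Y eq = ∣ℤ⇒invertible u X (divides Y (begin
      u * X - 1ℤ               ≡⟨ cong (_- 1ℤ) (*-comm u X) ⟩
      X * u - 1ℤ               ≡⟨ cong (_- 1ℤ) (sym eq) ⟩
      1ℤ + Y * + N - 1ℤ        ≡⟨ add-sub-cancel 1ℤ (Y * + N) ⟩
      Y * + N                  ∎))

  bézout⁻⇒invertible : ∀ {N} u X Y → 1ℤ + X * u ≡ Y * + N → InvertibleMod N u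
  bézout⁻⇒invertible {N} u X Y eq = ∣ℤ⇒invertible u (- X) (divides (- Y) (begin
      u * - X - 1ℤ             ≡⟨ negate u X ⟩
      - (1ℤ + X * u)           ≡⟨ cong -_ eq ⟩
      - (Y * + N)              ≡⟨ neg-distribˡ-* Y (+ N) ⟩
      - Y * + N                ∎))
    where
    negate : ∀ u X → u * - X - 1ℤ ≡ - (1ℤ + X * u)
    negate = solve-∀

  gcd≡1⇒invertible : ∀ N .{{_ : ℕ.NonZero N}} a → gcd (a %ℕ N) N ≡ 1 → InvertibleMod N a
  gcd≡1⇒invertible N a gcd≡1 =
    invertible-resp-≡mod a (+ u) (≡mod-residue N a) (residue-invertible bézout)
    where
    u : ℕ
    u = a %ℕ N
    bézout : Bézout.Identity 1 u N
    bézout = Bézout.identity (subst (GCD u N) gcd≡1 (gcd-GCD u N))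
    residue-invertible : Bézout.Identity 1 u N → InvertibleMod N (+ u)
    residue-invertible (Bézout.+- x y eq) =
      bézout⁺⇒invertible (+ u) (+ x) (+ y)
        (trans (sym (pos-affine 1 y N)) (trans (cong +_ eq) (pos-* x u)))
    residue-invertible (Bézout.-+ x y eq) =
      bézout⁻⇒invertible (+ u) (+ x) (+ y)
        (trans (sym (pos-affine 1 x u)) (trans (cong +_ eq) (pos-* y N)))

  gcd≡N⇒divisible : ∀ N .{{_ : ℕ.NonZero N}} a → gcd (a %ℕ N) N ≡ N → + N ∣ℤ a
  gcd≡N⇒divisible N a gcd≡N =
    subst (+ N ∣ℤ_) (+-identityʳ a) (subst (λ v → + N ∣ℤ a - + v) residue≡0 (≡mod-residue N a))
    where
    u : ℕ
    u = a %ℕ N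
    N∣u : N ℕ.∣ u
    N∣u = subst (ℕ._∣ u) gcd≡N (gcd[m,n]∣m u N)
    residue≡0 : u ≡ 0
    residue≡0 = trans (sym (m<n⇒m%n≡m (n%ℕd<d a N))) (ℕ.n∣m⇒m%n≡0 u N N∣u)

  Hk-divisible : ∀ d minv r k x t → t ℕ.< k → d ∣ℤ H minv r (x + + t) → d ∣ℤ Hk minv r k x
  Hk-divisible d minv r (suc k) x t t<1+k d∣H with ℕ.m<1+n⇒m<n∨m≡n t<1+k
  ... | inj₁ t<k  = ∣m⇒∣m*n (H minv r (x + + k)) (Hk-divisible d minv r k x t t<k d∣H)
  ... | inj₂ refl = ∣n⇒∣m*n (Hk minv r k x) d∣H

  coprime? : ∀ N .{{_ : ℕ.NonZero N}} a → Dec (gcd (a %ℕ N) N ≡ 1)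
  coprime? N a = gcd (a %ℕ N) N ℕ.≟ 1

  -- If H_k(x) is not a unit of ℤ_N, then neither is some factor H(x + t):
  -- its residue is not coprime to N (a product of units is a unit).
  noninvertible⇒factor : ∀ N .{{_ : ℕ.NonZero N}} minv r k x → ¬ InvertibleMod N (Hk minv r k x) →
    ∃[ t ] (t ℕ.< k × gcd (H minv r (x + + t) %ℕ N) N ≢ 1)
  noninvertible⇒factor N minv r zero x noninv =
    ⊥-elim (noninv (∣ℤ⇒invertible 1ℤ 1ℤ (divides 0ℤ refl)))
  noninvertible⇒factor N minv r (suc k) x noninv with coprime? N (H minv r (x + + k))
  ... | no  gcd≢1 = k , ℕ.n<1+n k , gcd≢1
  ... | yes gcd≡1 = widen (noninvertible⇒factor N minv r k x noninv-prefix)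
    where
    noninv-prefix : ¬ InvertibleMod N (Hk minv r k x)
    noninv-prefix inv = noninv (invertible-* (Hk minv r k x) (H minv r (x + + k)) inv
                                  (gcd≡1⇒invertible N (H minv r (x + + k)) gcd≡1))
    widen : ∃[ t ] (t ℕ.< k × gcd (H minv r (x + + t) %ℕ N) N ≢ 1) →
            ∃[ t ] (t ℕ.< suc k × gcd (H minv r (x + + t) %ℕ N) N ≢ 1)
    widen (t , t<k , gcd≢1) = t , ℕ.m<n⇒m<1+n t<k , gcd≢1

  -- The central identity: since m m⁻¹ ≡ 1, multiplying H(-(n + 1 + t) + t) by m
  -- gives -(r + n m) up to a multiple of the defect m m⁻¹ - 1.
  scaled-H : ∀ m minv r {jk} n t → jk ≡ n ℕ.+ suc t →
    + m * H minv r (- + jk + + t) ≡ - + (r ℕ.+ n ℕ.* m) - + r * (+ m * minv - 1ℤ)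
  scaled-H m minv r {jk} n t jk≡ = begin
      + m * H minv r (- + jk + + t)
        ≡⟨ cong (λ v → + m * H minv r (- v + + t)) jk-cast ⟩
      + m * H minv r (- (+ n + (1ℤ + + t)) + + t)
        ≡⟨ expand (+ m) minv (+ r) (+ n) (+ t) ⟩
      - (+ r + + n * + m) - + r * (+ m * minv - 1ℤ)
        ≡⟨ cong (λ v → - v - + r * (+ m * minv - 1ℤ)) (sym (pos-affine r n m)) ⟩
      - + (r ℕ.+ n ℕ.* m) - + r * (+ m * minv - 1ℤ) ∎
    where
    jk-cast : + jk ≡ + n + (1ℤ + + t)
    jk-cast = trans (cong +_ jk≡) (trans (pos-+ n (suc t)) (cong (λ v → + n + v) (pos-+ 1 t)))
    expand : ∀ M mi R Q T → M * (- (Q + (1ℤ + T)) + T - mi * R + 1ℤ) ≡ - (R + Q * M) - R * (M * mi - 1ℤ)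
    expand = solve-∀

  scaled-H-divisible : ∀ {d} m minv r {jk} n t → d ∣ℤ + m * minv - 1ℤ → jk ≡ n ℕ.+ suc t →
    (d ∣ℤ + m * H minv r (- + jk + + t)) ⇔ (d ∣ℤ + (r ℕ.+ n ℕ.* m))
  scaled-H-divisible {d} m minv r {jk} n t d∣defect jk≡ = mk⇔
    (λ d∣mH → subst (d ∣ℤ_) (neg-involutive X)
                (∣m⇒∣-m (∣m+n∣n⇒∣m (subst (d ∣ℤ_) identity d∣mH) (∣m⇒∣-m d∣Y))))
    (λ d∣X → subst (d ∣ℤ_) (sym identity) (∣m∣n⇒∣m-n (∣m⇒∣-m d∣X) d∣Y))
    where
    X Y : ℤ
    X = + (r ℕ.+ n ℕ.* m)
    Y = + r * (+ m * minv - 1ℤ)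
    identity : + m * H minv r (- + jk + + t) ≡ - X - Y
    identity = scaled-H m minv r n t jk≡
    d∣Y : d ∣ℤ Y
    d∣Y = ∣n⇒∣m*n (+ r) d∣defect

  -- Writing the argument of H as in the paper: x - m⁻¹ r + (t + 1) = H(x + t).
  H-shift : ∀ minv r x t → x - minv * + r + + suc t ≡ H minv r (x + + t)
  H-shift minv r x t =
    trans (cong (λ v → x - minv * + r + v) (pos-+ 1 t)) (reassociate x (minv * + r) (+ t))
    where
    reassociate : ∀ x A T → x - A + (1ℤ + T) ≡ x + T - A + 1ℤ
    reassociate = solve-∀

  prime∣m*a⇒prime∣a : ∀ {p m} .{{_ : ℕ.NonZero m}} a → Prime p → m ℕ.< p → + p ∣ℤ + m * a → + p ∣ℤ a
  prime∣m*a⇒prime∣a {p} {m} a pp m<p p∣ma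
    with euclidsLemma m ∣ a ∣ pp (subst (p ℕ.∣_) (abs-* (+ m) a) (∣⇒∣ᵤ p∣ma))
  ... | inj₁ p∣m = ⊥-elim (ℕ.<⇒≱ m<p (ℕ.∣⇒≤ p∣m))
  ... | inj₂ p∣a = ∣ᵤ⇒∣ p∣a

open import Defs
open import Data.Nat using (ℕ; _≤_; _<_; _*_; _%_; NonZero)
open import Data.Nat.Divisibility using (_∣_)
open import Data.Nat.Primality using (Prime; Composite)
open import Data.Nat.GCD using (gcd)
open import Data.Integer as ℤ using (ℤ; +_; _%ℕ_)
open import Data.Product using (∃-syntax; _×_)
open import Relation.Binary.PropositionalEquality using (_≡_; _≢_)
open import Relation.Nullary using (¬_)

open import Data.Nat using (zero; suc; _+_; _∸_; z≤n; s≤s; >-nonZero; n>1⇒nonTrivial)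
open import Data.Nat.Properties
open import Data.Nat.DivMod using (_/_; m≡m%n+[m/n]*n; m%n<n; m<n*o⇒m/o<n)
open import Data.Nat.Divisibility using (m%n≡0⇒n∣m; hasNonTrivialDivisor; >⇒∤)
open import Data.Nat.Primality using (prime⇒¬composite)
open import Data.Nat.Tactic.RingSolver using (solve-∀)
open import Data.Integer.Divisibility.Signed using (∣-refl; ∣-trans; ∣ᵤ⇒∣; ∣⇒∣ᵤ; ∣n⇒∣m*n)
  renaming (_∣_ to _∣ℤ_)
open import Data.Product using (_,_)
open import Data.Empty using (⊥-elim)
open import Function.Bundles using (Equivalence)
open import Relation.Binary.PropositionalEquality using (refl; sym; cong; subst; module ≡-Reasoning)
open UnitsModN

-- A prime p is not a multiple of any m with 2 ≤ m < p, so r = p mod m is positive.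
prime%m>0 : ∀ p m .{{_ : NonZero m}} → Prime p → 2 ≤ m → m < p → 0 < p % m
prime%m>0 p m pp 2≤m m<p = n≢0⇒n>0 λ p%m≡0 → prime⇒¬composite pp
  (hasNonTrivialDivisor {{n>1⇒nonTrivial 2≤m}} m<p (m%n≡0⇒n∣m p m p%m≡0))

-- Every q < k² is of the form (d + 1) k - (t + 1) with d, t < k: q lies in the
-- block [d k, (d + 1) k), one of the k blocks of length k covering [0, k²).
block-decomposition : ∀ k q → q < k * k → ∃[ d ] ∃[ t ] (d < k × t < k × suc d * k ≡ q + suc t)
block-decomposition (suc k′) q q<k² = d , t , m<n*o⇒m/o<n q<k² , t<k , jk≡
  where
  k d e t : ℕ
  k = suc k′
  d = q / k
  e = q % k
  t = k ∸ suc e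
  t+e+1≡k : t + suc e ≡ k
  t+e+1≡k = m∸n+n≡m (m%n<n q k)
  t<k : t < k
  t<k = subst (t <_) t+e+1≡k (m<m+n t (s≤s z≤n))
  rearrange : ∀ t e D → t + (1 + e) + D ≡ e + D + (1 + t)
  rearrange = solve-∀
  jk≡ : suc d * k ≡ q + suc t
  jk≡ = begin
    k + d * k                ≡⟨ cong (_+ d * k) (sym t+e+1≡k) ⟩
    t + suc e + d * k        ≡⟨ rearrange t e (d * k) ⟩
    e + d * k + suc t        ≡⟨ cong (_+ suc t) (sym (m≡m%n+[m/n]*n q k)) ⟩
    q + suc t                ∎
    where open ≡-Reasoning

ceil-upper : ∀ b m k → IsCeilSqrtDiv b m k → b ≤ m * (k * k)
ceil-upper b m zero    b≤0       = subst (b ≤_) (sym (*-zeroʳ m)) b≤0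
ceil-upper b m (suc k) (b≤ , _)  = b≤

-- Minimality of k = ⌈(b/m)^{1/2}⌉ bounds m k² by 4 b (using (k+1)² ≤ 4 k² for k ≥ 1);
-- the hypothesis m < b covers k = 1.
ceil-square-bound : ∀ b m k → IsCeilSqrtDiv b m k → m < b → m * (k * k) < 4 * b
ceil-square-bound b m zero          b≤0      m<b = ⊥-elim (<⇒≱ m<b (≤-trans b≤0 z≤n))
ceil-square-bound b m (suc zero)    _        m<b = begin-strict
  m * 1      ≡⟨ *-identityʳ m ⟩
  m          <⟨ m<b ⟩
  b          ≤⟨ m≤n*m b 4 ⟩
  4 * b      ∎
  where open ≤-Reasoning
ceil-square-bound b m (suc (suc n)) (_ , lt) m<b = begin-strict
  m * ((2 + n) * (2 + n))                          ≤⟨ m≤m+n _ _ ⟩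
  m * ((2 + n) * (2 + n)) + m * ((3 * n + 4) * n)  ≡⟨ square-growth m n ⟩
  4 * (m * ((1 + n) * (1 + n)))                    <⟨ *-monoʳ-< 4 lt ⟩
  4 * b                                            ∎
  where
  open ≤-Reasoning
  square-growth : ∀ m n → m * ((2 + n) * (2 + n)) + m * ((3 * n + 4) * n) ≡ 4 * (m * ((1 + n) * (1 + n)))
  square-growth = solve-∀

residue-bound : ∀ N b m k r s → IsCeilSqrtDiv b m k → m < b → 5 * b ≤ N →
  r < m → suc s ≤ k * k → r + s * m < N
residue-bound N b m k r s ceil m<b 5b≤N r<m s<k² = begin-strict
  r + s * m      <⟨ +-monoˡ-< (s * m) r<m ⟩
  suc s * m      ≤⟨ *-monoˡ-≤ m s<k² ⟩
  k * k * m      ≡⟨ *-comm (k * k) m ⟩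
  m * (k * k)    <⟨ ceil-square-bound b m k ceil m<b ⟩
  4 * b          ≤⟨ *-monoˡ-≤ b (n≤1+n 4) ⟩
  5 * b          ≤⟨ 5b≤N ⟩
  N              ∎
  where open ≤-Reasoning

-- First assertion: writing p = r + q m, the index q < k² lies in some block j = d + 1,
-- and then p divides m H(-jk + t), hence H(-jk + t), hence H_k(-jk).
some-Hk-noninvertible : ∀ N p b r m k .{{_ : NonZero N}} .{{_ : NonZero m}} (minv : ℤ) →
  Prime p → p ∣ N → p ≤ b → 2 ≤ m → m < p → r ≡ p % m →
  IsInverseMod N m minv → IsCeilSqrtDiv b m k →
  ∃[ j ] (1 ≤ j × j ≤ k × ¬ InvertibleMod N (Hk minv r k (ℤ.- (+ (j * k)))))
some-Hk-noninvertible N p b r m k minv pp p∣N p≤b 2≤m m<p refl inv ceil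
  with block-decomposition k (p / m) q<k²
  where
  q<k² : p / m < k * k
  q<k² = *-cancelʳ-< m (p / m) (k * k) (begin-strict
    p / m * m               <⟨ m<n+m (p / m * m) (prime%m>0 p m pp 2≤m m<p) ⟩
    p % m + p / m * m       ≡⟨ sym (m≡m%n+[m/n]*n p m) ⟩
    p                       ≤⟨ p≤b ⟩
    b                       ≤⟨ ceil-upper b m k ceil ⟩
    m * (k * k)             ≡⟨ *-comm m (k * k) ⟩
    k * k * m               ∎)
    where open ≤-Reasoning
... | d , t , d<k , t<k , jk≡ =
  suc d , s≤s z≤n , d<k ,
  prime-factor⇒noninvertible _ pp p∣N (Hk-divisible (+ p) minv (p % m) k _ t t<k p∣H)
  where
  p∣N-defect : + p ∣ℤ + m ℤ.* minv ℤ.- + 1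
  p∣N-defect = ∣-trans (∣ᵤ⇒∣ {+ p} {+ N} p∣N) (∣ᵤ⇒∣ inv)
  p∣r+qm : + p ∣ℤ + (p % m + p / m * m)
  p∣r+qm = subst (λ v → + p ∣ℤ + v) (m≡m%n+[m/n]*n p m) ∣-refl
  p∣H : + p ∣ℤ H minv (p % m) (ℤ.- + (suc d * k) ℤ.+ + t)
  p∣H = prime∣m*a⇒prime∣a _ pp m<p
          (Equivalence.from (scaled-H-divisible m minv (p % m) (p / m) t p∣N-defect jk≡) p∣r+qm)

-- Second assertion: some factor H(-jk + t) = -jk - m⁻¹ r + (t + 1) of a non-unit H_k(-jk)
-- has gcd ≠ 1 with N; the gcd is not N either, for N ∣ H(-jk + t) would force
-- N ∣ r + s m with s = jk - (t + 1), although 0 < r + s m < N.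
noninvertible-Hk⇒factor : ∀ N p b r m k .{{_ : NonZero N}} .{{_ : NonZero m}} (minv : ℤ) →
  Prime p → p ≤ b → 5 * b ≤ N → 2 ≤ m → m < p → r ≡ p % m →
  IsInverseMod N m minv → IsCeilSqrtDiv b m k →
  ∀ j → 1 ≤ j → j ≤ k → ¬ InvertibleMod N (Hk minv r k (ℤ.- (+ (j * k)))) →
  ∃[ i ] (1 ≤ i × i ≤ k ×
    (gcd ((ℤ.- (+ (j * k)) ℤ.- minv ℤ.* (+ r) ℤ.+ (+ i)) %ℕ N) N ≢ 1) ×
    (gcd ((ℤ.- (+ (j * k)) ℤ.- minv ℤ.* (+ r) ℤ.+ (+ i)) %ℕ N) N ≢ N))
noninvertible-Hk⇒factor N p b r m k minv pp p≤b 5b≤N 2≤m m<p refl inv ceil j 1≤j j≤k noninv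
  with noninvertible⇒factor N minv r k (ℤ.- + (j * k)) noninv
... | t , t<k , gcd≢1 =
  suc t , s≤s z≤n , t<k , (λ gcd≡1 → gcd≢1 (subst coprime (H-shift minv r x t) gcd≡1)) , gcd≢N
  where
  x : ℤ
  x = ℤ.- + (j * k)
  coprime : ℤ → Set
  coprime a = gcd (a %ℕ N) N ≡ 1
  s : ℕ
  s = j * k ∸ suc t
  jk≡ : j * k ≡ s + suc t
  jk≡ = sym (m∸n+n≡m (≤-trans t<k (m≤n*m k j {{>-nonZero 1≤j}})))
  s<k² : suc s ≤ k * k
  s<k² = ≤-trans (subst (suc s ≤_) (sym jk≡) (m<m+n s (s≤s z≤n))) (*-monoˡ-≤ k j≤k)
  0<r : 0 < r
  0<r = prime%m>0 p m pp 2≤m m<p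
  bound : r + s * m < N
  bound = residue-bound N b m k r s ceil (<-≤-trans m<p p≤b) 5b≤N (m%n<n p m) s<k²
  gcd≢N : gcd ((x ℤ.- minv ℤ.* + r ℤ.+ + suc t) %ℕ N) N ≢ N
  gcd≢N gcd≡N = >⇒∤ {{>-nonZero (<-≤-trans 0<r (m≤m+n r (s * m)))}} bound (∣⇒∣ᵤ N∣r+sm)
    where
    N∣H : + N ∣ℤ H minv r (x ℤ.+ + t)
    N∣H = subst (+ N ∣ℤ_) (H-shift minv r x t) (gcd≡N⇒divisible N _ gcd≡N)
    N∣r+sm : + N ∣ℤ + (r + s * m)
    N∣r+sm = Equivalence.to (scaled-H-divisible m minv r s t (∣ᵤ⇒∣ inv) jk≡) (∣n⇒∣m*n (+ m) N∣H)

-- The corollary is the conjunction of the two assertions.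
corollary2p6 : (N p b r m k : ℕ) → .{{_ : NonZero N}} → .{{_ : NonZero m}} → (minv : ℤ) →
    Composite N → Prime p → p ∣ N → p ≤ b → 5 * b ≤ N →
    2 ≤ m → m < p → gcd N m ≡ 1 → r ≡ p % m →
    IsInverseMod N m minv → IsCeilSqrtDiv b m k →
    (∃[ j ] (1 ≤ j × j ≤ k × ¬ InvertibleMod N (Hk minv r k (ℤ.- (+ (j * k))))))
    × (∀ j → 1 ≤ j → j ≤ k → ¬ InvertibleMod N (Hk minv r k (ℤ.- (+ (j * k)))) →
        ∃[ i ] (1 ≤ i × i ≤ k ×
          (gcd ((ℤ.- (+ (j * k)) ℤ.- minv ℤ.* (+ r) ℤ.+ (+ i)) %ℕ N) N ≢ 1) ×
          (gcd ((ℤ.- (+ (j * k)) ℤ.- minv ℤ.* (+ r) ℤ.+ (+ i)) %ℕ N) N ≢ N)))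
corollary2p6 N p b r m k minv _ pp p∣N p≤b 5b≤N 2≤m m<p _ r≡p%m inv ceil =
  some-Hk-noninvertible N p b r m k minv pp p∣N p≤b 2≤m m<p r≡p%m inv ceil ,
  noninvertible-Hk⇒factor N p b r m k minv pp p≤b 5b≤N 2≤m m<p r≡p%m inv ceil
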